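{- Let $G=(V,E)$ be a finite connected simple graph which contains a cycle (of length at least $3$). Then $\Lambda_1(G)=\infty$, i.e. for every $M>0$ there is an edge-length function $l\colon E\to\mathbb{R}_{>0}$ with $2\sum_{uv\in E} l(uv)=1$ and $\lambda_1(G,l)>M$.
   Context: For a finite connected simple graph $G=(V,E)$ and an edge-length function $l\colon E\to\mathbb{R}_{>0}$, define the vertex weight $m_0(u)=\sum_{v\sim u} l(uv)$ and edge weight $m_1(uv)=1/l(uv)$. The Fujiwara Laplacian $\Delta_l$ acts on functions $\varphi\colon V\to\mathbb{R}$ by $(\Delta_l\varphi)(u)=\sum_{v\sim u}\frac{m_1(uv)}{m_0(u)}(\varphi(u)-\varphi(v))$; it is self-adjoint and nonnegative with respect to the inner product $\langle\varphi_1,\varphi_2\rangle=\sum_{u} m_0(u)\varphi_1(u)\varphi_2(u)$, its kernel consists of the constants, and $\lambda_1(G,l)$ denotes its smallest positive eigenvalue, equivalently $\lambda_1(G,l)=\min\frac{\sum_{uv\in E} m_1(uv)(\varphi(u)-\varphi(v))^2}{\sum_{u\in V} m_0(u)\varphi(u)^2}$ over nonzero $\varphi$ with $\sum_u m_0(u)\varphi(u)=0$. Define $\Lambda_1(G)=\sup_l \lambda_1(G,l)$ over all $l$ satisfying the normalization $\sum_{u\in V} m_0(u)=2\sum_{uv\in E}l(uv)=1$; equivalently $\Lambda_1(G)=\sup_l \lambda_1(G,l)\,\bigl(\sum_{u}m_0(u)\bigr)^2$ over all (unnormalized) $l$.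
   Formalization: The number M ranges over the positive rationals, the edge-length function l takes rational values, and so do the test functions φ in the Rayleigh-quotient characterization of λ₁(G,l). -}

module Defs where

open import Data.Nat using (ℕ; zero; suc)
import Data.Nat as ℕ
open import Data.Fin using (Fin; toℕ)
import Data.Fin as F
open import Data.Bool using (Bool; true; false; if_then_else_; _∧_)
open import Data.Vec using (Vec; lookup)
open import Data.Rational using (ℚ; 0ℚ; _+_; _*_; _-_; _<_; 1/_; ≢-nonZero)
open import Data.Rational.Properties using (_≟_)
open import Data.Product using (Σ; ∃; _×_; _,_)
open import Relation.Nullary using (yes; no; ¬_)
open import Relation.Binary.PropositionalEquality using (_≡_; _≢_)
open import Function.Definitions using (Injective)

record Graph : Set where
  field
    n     : ℕ
    adj   : Fin n → Fin n → Bool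
    sym   : ∀ u v → adj u v ≡ adj v u
    irrefl : ∀ u → adj u u ≡ false
open Graph public

sumFin : (k : ℕ) → (Fin k → ℚ) → ℚ
sumFin zero    f = 0ℚ
sumFin (suc k) f = f F.zero + sumFin k (λ i → f (F.suc i))

data Reach (G : Graph) : Fin (n G) → Fin (n G) → Set where
  here : ∀ {u} → Reach G u u
  step : ∀ {u w v} → adj G u w ≡ true → Reach G w v → Reach G u v

Connected : Graph → Set
Connected G = ∀ u v → Reach G u v

HasCycle : Graph → Set
HasCycle G = Σ ℕ λ k → Σ (Vec (Fin (n G)) (suc (suc (suc k)))) λ c →
    Injective _≡_ _≡_ (lookup c)
  × (∀ (i : Fin (suc (suc k))) → adj G (lookup c (F.inject₁ i)) (lookup c (F.suc i)) ≡ true)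
  × adj G (lookup c (F.fromℕ (suc (suc k)))) (lookup c F.zero) ≡ true

-- total reciprocal (only ever applied to positive edge lengths)
inv : ℚ → ℚ
inv p with p ≟ 0ℚ
... | yes _ = 0ℚ
... | no p≢0 = 1/_ p {{≢-nonZero p≢0}}

-- An edge-length function is represented by l : Fin n → Fin n → ℚ whose
-- values on edges matter only; it must be symmetric and positive on edges.
IsEdgeLength : (G : Graph) → (Fin (n G) → Fin (n G) → ℚ) → Set
IsEdgeLength G l = ∀ u v → adj G u v ≡ true → (l u v ≡ l v u) × (0ℚ < l u v)

adjSum : (G : Graph) → (Fin (n G) → Fin (n G) → ℚ) → ℚ
adjSum G f = sumFin (n G) λ u → sumFin (n G) λ v → if adj G u v then f u v else 0ℚ

edgeSum : (G : Graph) → (Fin (n G) → Fin (n G) → ℚ) → ℚ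
edgeSum G f = sumFin (n G) λ u → sumFin (n G) λ v →
  if adj G u v ∧ (toℕ u ℕ.<ᵇ toℕ v) then f u v else 0ℚ

m₀ : (G : Graph) → (Fin (n G) → Fin (n G) → ℚ) → Fin (n G) → ℚ
m₀ G l u = sumFin (n G) λ v → if adj G u v then l u v else 0ℚ

m₁ : (G : Graph) → (Fin (n G) → Fin (n G) → ℚ) → Fin (n G) → Fin (n G) → ℚ
m₁ G l u v = inv (l u v)

totalMass : (G : Graph) → (Fin (n G) → Fin (n G) → ℚ) → ℚ
totalMass G l = sumFin (n G) (m₀ G l)

dirichlet : (G : Graph) → (Fin (n G) → Fin (n G) → ℚ) → (Fin (n G) → ℚ) → ℚ
dirichlet G l φ = edgeSum G λ u v → m₁ G l u v * ((φ u - φ v) * (φ u - φ v))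

mass : (G : Graph) → (Fin (n G) → Fin (n G) → ℚ) → (Fin (n G) → ℚ) → ℚ
mass G l φ = sumFin (n G) λ u → m₀ G l u * (φ u * φ u)

mean : (G : Graph) → (Fin (n G) → Fin (n G) → ℚ) → (Fin (n G) → ℚ) → ℚ
mean G l φ = sumFin (n G) λ u → m₀ G l u * φ u

-- λ₁(G,l) > M, stated through the Rayleigh-quotient characterisation
-- (test functions φ rational)
λ₁> : (G : Graph) → (Fin (n G) → Fin (n G) → ℚ) → ℚ → Set
λ₁> G l M = ∀ (φ : Fin (n G) → ℚ) → (∃ λ u → φ u ≢ 0ℚ) → mean G l φ ≡ 0ℚ →
  M * mass G l φ < dirichlet G l φ

{-# OPTIONS --safe #-}
module Submission where

-- Make one edge ab of the cycle heavy: every other edge gets a small length ε, and ab takes the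
-- rest of the unit mass. As ab lies on a cycle, G − ab is still connected, so every vertex u is
-- joined to a by a walk of light edges. On a light edge m₁ = 1/ε, so (φ x − φ y)² ≤ ε D(φ) for
-- the Dirichlet energy D, and along the walk (φ u − φ a)² ≤ K ε D(φ) with K depending on G only.
-- For φ of mean zero, Σ m₀ φ² ≤ Σ m₀ (φ − φ a)² ≤ K ε D(φ), so choosing M K ε < 1 gives λ₁ > M.

open import Defs hiding (sym)
open import Data.Fin using (Fin)
open import Data.Rational using (ℚ; 0ℚ; 1ℚ; _<_)
open import Data.Product using (Σ; _×_)
open import Relation.Binary.PropositionalEquality using (_≡_)

open import Level using (0ℓ)
open import Function using (_∘_; mk⇔; case_of_; Equivalence)
open import Data.Bool using (Bool; true; false; if_then_else_; _∧_)
open import Data.Bool.Properties using (T-≡)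
open import Data.Nat as ℕ using (zero; suc)
import Data.Nat.Properties as ℕ
open import Data.Fin as Fin using (toℕ; inject₁; fromℕ)
open import Data.Fin.Properties using (toℕ-injective; _≟_)
open import Data.Vec using (Vec; []; _∷_; lookup)
open import Data.Rational
  using (_≤_; _+_; _*_; _-_; -_; 1/_; Positive; nonNegative; nonPositive; positive; negative)
open import Data.Rational.Properties renaming (_≟_ to _≟ℚ_)
open import Data.Rational.Solver using (module +-*-Solver)
open import Data.Product using (_,_; proj₁; proj₂; ∃)
open import Data.Sum using (_⊎_; inj₁; inj₂)
open import Relation.Nullary using (¬_; yes; no; does; contradiction)
open import Relation.Nullary.Decidable using (_×-dec_; _⊎-dec_; does-⇔; dec-true; dec-false)
open import Relation.Binary using (Rel; Decidable; Sym; _⇒_; tri<; tri≈; tri>)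
open import Relation.Binary.PropositionalEquality
  using (_≢_; refl; sym; trans; cong; cong₂; subst; subst₂; module ≡-Reasoning)
open import Relation.Binary.Construct.Closure.ReflexiveTransitive as Star
  using (Star; _◅_; _◅◅_; reverse; return; _⋆)
open import Algebra.Bundles using (CommutativeRing)
import Algebra.Properties.Semiring.Sum as SemiringSum
open import Algebra.Properties.Group +-0-group using (x∙y⁻¹≈ε⇒x≈y)

open +-*-Solver

module ∑ = SemiringSum (CommutativeRing.semiring +-*-commutativeRing)

sumFin≡sum : ∀ k (f : Fin k → ℚ) → sumFin k f ≡ ∑.sum f
sumFin≡sum zero    f = refl
sumFin≡sum (suc k) f = cong (f Fin.zero +_) (sumFin≡sum k (f ∘ Fin.suc))

sumFin-cong : ∀ k {f g : Fin k → ℚ} → (∀ i → f i ≡ g i) → sumFin k f ≡ sumFin k g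
sumFin-cong k {f} {g} f≗g =
  trans (sumFin≡sum k f) (trans (∑.sum-cong-≗ f≗g) (sym (sumFin≡sum k g)))

sumFin-distrib-+ : ∀ k (f g : Fin k → ℚ) →
  sumFin k (λ i → f i + g i) ≡ sumFin k f + sumFin k g
sumFin-distrib-+ k f g = trans (sumFin≡sum k _)
  (trans (∑.∑-distrib-+ f g) (sym (cong₂ _+_ (sumFin≡sum k f) (sumFin≡sum k g))))

*-distribˡ-sumFin : ∀ k p (f : Fin k → ℚ) → p * sumFin k f ≡ sumFin k (λ i → p * f i)
*-distribˡ-sumFin k p f = trans (cong (p *_) (sumFin≡sum k f))
  (trans (∑.*-distribˡ-sum p f) (sym (sumFin≡sum k _)))

*-distribʳ-sumFin : ∀ k p (f : Fin k → ℚ) → sumFin k f * p ≡ sumFin k (λ i → f i * p)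
*-distribʳ-sumFin k p f = trans (cong (_* p) (sumFin≡sum k f))
  (trans (∑.*-distribʳ-sum p f) (sym (sumFin≡sum k _)))

sumFin-linear : ∀ k p q (f g : Fin k → ℚ) →
  sumFin k (λ i → p * f i + q * g i) ≡ p * sumFin k f + q * sumFin k g
sumFin-linear k p q f g = trans (sumFin-distrib-+ k _ _)
  (sym (cong₂ _+_ (*-distribˡ-sumFin k p f) (*-distribˡ-sumFin k q g)))

p≤p+q : ∀ {p q} → 0ℚ ≤ q → p ≤ p + q
p≤p+q {p} {q} q≥0 = subst (_≤ p + q) (+-identityʳ p) (+-monoʳ-≤ p q≥0)

p≤q+p : ∀ {p q} → 0ℚ ≤ q → p ≤ q + p
p≤q+p {p} {q} q≥0 = subst (p ≤_) (+-comm p q) (p≤p+q q≥0)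

sumFin-mono-≤ : ∀ k {f g : Fin k → ℚ} → (∀ i → f i ≤ g i) → sumFin k f ≤ sumFin k g
sumFin-mono-≤ zero    f≤g = ≤-refl
sumFin-mono-≤ (suc k) f≤g = +-mono-≤ (f≤g Fin.zero) (sumFin-mono-≤ k (f≤g ∘ Fin.suc))

sumFin-nonneg : ∀ k {f : Fin k → ℚ} → (∀ i → 0ℚ ≤ f i) → 0ℚ ≤ sumFin k f
sumFin-nonneg zero    f≥0 = ≤-refl
sumFin-nonneg (suc k) f≥0 = +-mono-≤ (f≥0 Fin.zero) (sumFin-nonneg k (f≥0 ∘ Fin.suc))

term≤sumFin : ∀ k {f : Fin k → ℚ} → (∀ i → 0ℚ ≤ f i) → ∀ i → f i ≤ sumFin k f
term≤sumFin (suc k) f≥0 Fin.zero    = p≤p+q (sumFin-nonneg k (f≥0 ∘ Fin.suc))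
term≤sumFin (suc k) f≥0 (Fin.suc i) =
  ≤-trans (term≤sumFin k (f≥0 ∘ Fin.suc) i) (p≤q+p (f≥0 Fin.zero))

term≤sumFin² : ∀ k {f : Fin k → Fin k → ℚ} → (∀ i j → 0ℚ ≤ f i j) →
  ∀ i j → f i j ≤ sumFin k (λ i → sumFin k (f i))
term≤sumFin² k f≥0 i j = ≤-trans (term≤sumFin k (f≥0 i) j)
  (term≤sumFin k (λ i → sumFin-nonneg k (f≥0 i)) i)

sq : ℚ → ℚ
sq p = p * p

two : ℚ
two = 1ℚ + 1ℚ

sq-nonneg : ∀ p → 0ℚ ≤ sq p
sq-nonneg p with ≤-total 0ℚ p
... | inj₁ p≥0 = nonNegative⁻¹ _ {{nonNeg*nonNeg⇒nonNeg p {{nonNegative p≥0}} p {{nonNegative p≥0}}}}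
... | inj₂ p≤0 = nonNegative⁻¹ _ {{nonPos*nonPos⇒nonPos p {{nonPositive p≤0}} p {{nonPositive p≤0}}}}

sq≤0⇒≡0 : ∀ p → sq p ≤ 0ℚ → p ≡ 0ℚ
sq≤0⇒≡0 p sq≤0 with <-cmp p 0ℚ
... | tri≈ _ p≡0 _ = p≡0
... | tri< p<0 _ _ = contradiction (<-≤-trans sq>0 sq≤0) (<-irrefl refl)
  where sq>0 = positive⁻¹ _ {{neg*neg⇒pos p {{negative p<0}} p {{negative p<0}}}}
... | tri> _ _ p>0 = contradiction (<-≤-trans sq>0 sq≤0) (<-irrefl refl)
  where sq>0 = positive⁻¹ _ {{pos*pos⇒pos p {{positive p>0}} p {{positive p>0}}}}

sq-diff-comm : ∀ p q → sq (p - q) ≡ sq (q - p)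
sq-diff-comm = solve 2 (λ p q → (p :- q) :* (p :- q) := (q :- p) :* (q :- p)) refl

sq-+-≤ : ∀ p q → sq (p + q) ≤ two * sq p + two * sq q
sq-+-≤ p q = subst₂ _≤_ (+-identityˡ _) (parallelogram p q) (+-monoˡ-≤ (sq (p + q)) (sq-nonneg (p - q)))
  where
  parallelogram : ∀ p q → sq (p - q) + sq (p + q) ≡ two * sq p + two * sq q
  parallelogram = solve 2 (λ p q → (p :- q) :* (p :- q) :+ (p :+ q) :* (p :+ q)
                         := (con 1ℚ :+ con 1ℚ) :* (p :* p) :+ (con 1ℚ :+ con 1ℚ) :* (q :* q)) refl

inv-pos : ∀ {p} (p>0 : 0ℚ < p) → inv p ≡ (1/ p) {{pos⇒nonZero p {{positive p>0}}}}
inv-pos {p} p>0 with p ≟ℚ 0ℚ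
... | yes p≡0 = contradiction (sym p≡0) (<⇒≢ p>0)
... | no _    = refl

inv-nonneg : ∀ {p} → 0ℚ < p → 0ℚ ≤ inv p
inv-nonneg {p} p>0 = subst (0ℚ ≤_) (sym (inv-pos p>0))
  (<⇒≤ (positive⁻¹ _ {{1/pos⇒pos p {{positive p>0}}}}))

*-inverseʳ-inv : ∀ {p} → 0ℚ < p → p * inv p ≡ 1ℚ
*-inverseʳ-inv {p} p>0 =
  trans (cong (p *_) (inv-pos p>0)) (*-inverseʳ p {{pos⇒nonZero p {{positive p>0}}}})

walkFactor : ∀ {a r} {A : Set a} {R : Rel A r} {x y} → Star R x y → ℚ
walkFactor Star.ε  = 0ℚ
walkFactor (_ ◅ w) = two + two * walkFactor w

walkFactor-nonneg : ∀ {a r} {A : Set a} {R : Rel A r} {x y} (w : Star R x y) → 0ℚ ≤ walkFactor w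
walkFactor-nonneg Star.ε   = ≤-refl
walkFactor-nonneg (_ ◅ w) = nonNegative⁻¹ _ {{nonNeg+nonNeg⇒nonNeg two (two * walkFactor w)
  {{nonNeg*nonNeg⇒nonNeg two (walkFactor w) {{nonNegative (walkFactor-nonneg w)}}}}}}

walk-sq-bound : ∀ {a r} {A : Set a} {R : Rel A r} (φ : A → ℚ) {Q : ℚ} →
  (∀ {x y} → R x y → sq (φ x - φ y) ≤ Q) →
  ∀ {x y} (w : Star R x y) → sq (φ x - φ y) ≤ walkFactor w * Q
walk-sq-bound φ {Q} edge≤ {x = x} Star.ε = ≤-reflexive (begin
  sq (φ x - φ x) ≡⟨ cong sq (+-inverseʳ (φ x)) ⟩
  0ℚ             ≡⟨ sym (*-zeroˡ Q) ⟩
  0ℚ * Q         ∎)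
  where open ≡-Reasoning
walk-sq-bound φ {Q} edge≤ {x = x} {y = z} (_◅_ {j = y} e w) = begin
  sq (φ x - φ z)                              ≡⟨ cong sq (telescope (φ x) (φ y) (φ z)) ⟩
  sq ((φ x - φ y) + (φ y - φ z))              ≤⟨ sq-+-≤ (φ x - φ y) (φ y - φ z) ⟩
  two * sq (φ x - φ y) + two * sq (φ y - φ z) ≤⟨ +-mono-≤ (*-monoˡ-≤-nonNeg two (edge≤ e))
                                                  (*-monoˡ-≤-nonNeg two (walk-sq-bound φ edge≤ w)) ⟩
  two * Q + two * (walkFactor w * Q)          ≡⟨ collect two Q (walkFactor w) ⟩
  (two + two * walkFactor w) * Q              ∎
  where
  open ≤-Reasoning
  telescope : ∀ p q r → p - r ≡ (p - q) + (q - r)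
  telescope = solve 3 (λ p q r → p :- r := (p :- q) :+ (q :- r)) refl
  collect : ∀ t q f → t * q + t * (f * q) ≡ (t + t * f) * q
  collect = solve 3 (λ t q f → t :* q :+ t :* (f :* q) := (t :+ t :* f) :* q) refl

Adj : (G : Graph) → Rel (Fin (n G)) 0ℓ
Adj G u v = adj G u v ≡ true

Adj-sym : ∀ {G} → Sym (Adj G) (Adj G)
Adj-sym {G} {u} {v} uv = trans (Graph.sym G v u) uv

Adj-irrefl : ∀ {G u} → ¬ Adj G u u
Adj-irrefl {G} {u} uu = case trans (sym uu) (Graph.irrefl G u) of λ ()

reach⇒walk : ∀ {G u v} → Reach G u v → Star (Adj G) u v
reach⇒walk here       = Star.ε
reach⇒walk (step e r) = e ◅ reach⇒walk r

SameEdge : ∀ {a} {A : Set a} → A → A → Rel A a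
SameEdge a b u v = (u ≡ a × v ≡ b) ⊎ (u ≡ b × v ≡ a)

SameEdge-sym : ∀ {a} {A : Set a} {x y : A} → Sym (SameEdge x y) (SameEdge x y)
SameEdge-sym (inj₁ (u≡x , v≡y)) = inj₂ (v≡y , u≡x)
SameEdge-sym (inj₂ (u≡y , v≡x)) = inj₁ (v≡x , u≡y)

sameEdge? : ∀ {k} (a b : Fin k) → Decidable (SameEdge a b)
sameEdge? a b u v = (u ≟ a ×-dec v ≟ b) ⊎-dec (u ≟ b ×-dec v ≟ a)

¬SameEdge-target : ∀ {a} {A : Set a} {x y u v : A} → v ≢ x → v ≢ y → ¬ SameEdge x y u v
¬SameEdge-target v≢x v≢y (inj₁ (_ , v≡y)) = v≢y v≡y
¬SameEdge-target v≢x v≢y (inj₂ (_ , v≡x)) = v≢x v≡x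

¬SameEdge-source : ∀ {a} {A : Set a} {x y u v : A} → u ≢ x → u ≢ y → ¬ SameEdge x y u v
¬SameEdge-source u≢x u≢y = ¬SameEdge-target u≢x u≢y ∘ SameEdge-sym

AdjAvoiding : (G : Graph) (a b : Fin (n G)) → Rel (Fin (n G)) 0ℓ
AdjAvoiding G a b u v = Adj G u v × ¬ SameEdge a b u v

AdjAvoiding-sym : ∀ {G a b} → Sym (AdjAvoiding G a b) (AdjAvoiding G a b)
AdjAvoiding-sym {G} (uv , ¬ab) = Adj-sym {G} uv , ¬ab ∘ SameEdge-sym

walkAlong : ∀ {a r} {A : Set a} {R : Rel A r} {m} (xs : Vec A (suc m)) →
  (∀ (i : Fin m) → R (lookup xs (inject₁ i)) (lookup xs (Fin.suc i))) →
  Star R (lookup xs Fin.zero) (lookup xs (fromℕ m))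
walkAlong (x ∷ [])     _     = Star.ε
walkAlong (x ∷ y ∷ ys) steps = steps Fin.zero ◅ walkAlong (y ∷ ys) (steps ∘ Fin.suc)

cycle⇒detour : ∀ G → HasCycle G →
  Σ (Fin (n G)) λ a → Σ (Fin (n G)) λ b → Adj G a b × Star (AdjAvoiding G a b) b a
cycle⇒detour G (k , a ∷ b ∷ cs , inj , steps , closing) =
  a , b , steps Fin.zero , walkAlong (b ∷ cs) onCycle ◅◅ return closingAvoids
  where
  ≢a : ∀ i → lookup cs i ≢ a
  ≢a i e = case inj {Fin.suc (Fin.suc i)} {Fin.zero} e of λ ()
  ≢b : ∀ i → lookup cs i ≢ b
  ≢b i e = case inj {Fin.suc (Fin.suc i)} {Fin.suc Fin.zero} e of λ ()
  onCycle : ∀ i → AdjAvoiding G a b (lookup (b ∷ cs) (inject₁ i)) (lookup cs i)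
  onCycle i = steps (Fin.suc i) , ¬SameEdge-target (≢a i) (≢b i)
  closingAvoids : AdjAvoiding G a b (lookup cs (fromℕ k)) a
  closingAvoids = closing , ¬SameEdge-source (≢a (fromℕ k)) (≢b (fromℕ k))

bypass : ∀ {G a b} → Star (AdjAvoiding G a b) b a →
  ∀ {u v} → Star (Adj G) u v → Star (AdjAvoiding G a b) u v
bypass {G} {a} {b} detour = replace ⋆
  where
  replace : Adj G ⇒ Star (AdjAvoiding G a b)
  replace {u} {v} uv with sameEdge? a b u v
  ... | no ¬ab                  = return (uv , ¬ab)
  ... | yes (inj₁ (refl , refl)) = reverse (AdjAvoiding-sym {G}) detour
  ... | yes (inj₂ (refl , refl)) = detour

sumFin-shift-sq : ∀ k (w f : Fin k → ℚ) c →
  sumFin k (λ i → w i * sq (f i - c)) ≡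
  sumFin k (λ i → w i * sq (f i)) + (- (two * c)) * sumFin k (λ i → w i * f i) + sq c * sumFin k w
sumFin-shift-sq k w f c = begin
  sumFin k (λ i → w i * sq (f i - c))
    ≡⟨ sumFin-cong k (λ i → expand (w i) (f i) c) ⟩
  sumFin k (λ i → w i * sq (f i) + (- (two * c)) * (w i * f i) + sq c * w i)
    ≡⟨ sumFin-distrib-+ k _ _ ⟩
  sumFin k (λ i → w i * sq (f i) + (- (two * c)) * (w i * f i)) + sumFin k (λ i → sq c * w i)
    ≡⟨ cong₂ _+_ (sumFin-distrib-+ k _ _) (sym (*-distribˡ-sumFin k (sq c) w)) ⟩
  sumFin k (λ i → w i * sq (f i)) + sumFin k (λ i → (- (two * c)) * (w i * f i)) + sq c * sumFin k w
    ≡⟨ cong (λ s → sumFin k (λ i → w i * sq (f i)) + s + sq c * sumFin k w)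
            (sym (*-distribˡ-sumFin k (- (two * c)) (λ i → w i * f i))) ⟩
  sumFin k (λ i → w i * sq (f i)) + (- (two * c)) * sumFin k (λ i → w i * f i) + sq c * sumFin k w ∎
  where
  open ≡-Reasoning
  expand : ∀ w f c → w * sq (f - c) ≡ w * sq f + (- (two * c)) * (w * f) + sq c * w
  expand = solve 3 (λ w f c → w :* ((f :- c) :* (f :- c))
                    := w :* (f :* f) :+ (:- ((con 1ℚ :+ con 1ℚ) :* c)) :* (w :* f) :+ (c :* c) :* w) refl

sumFin-weighted-const : ∀ k {w : Fin k → ℚ} → sumFin k w ≡ 1ℚ → ∀ c → sumFin k (λ i → w i * c) ≡ c
sumFin-weighted-const k {w} ∑w≡1 c =
  trans (sym (*-distribʳ-sumFin k c w)) (trans (cong (_* c) ∑w≡1) (*-identityˡ c))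

sumFin-weighted-≤ : ∀ k {w f : Fin k → ℚ} {B} → (∀ i → 0ℚ ≤ w i) → sumFin k w ≡ 1ℚ →
  (∀ i → f i ≤ B) → sumFin k (λ i → w i * f i) ≤ B
sumFin-weighted-≤ k {w} {f} {B} w≥0 ∑w≡1 f≤B = begin
  sumFin k (λ i → w i * f i) ≤⟨ sumFin-mono-≤ k (λ i → *-monoˡ-≤-nonNeg (w i) {{nonNegative (w≥0 i)}}
                                                                         (f≤B i)) ⟩
  sumFin k (λ i → w i * B)   ≡⟨ sumFin-weighted-const k ∑w≡1 B ⟩
  B                          ∎
  where open ≤-Reasoning

module _ (G : Graph) (f : Fin (n G) → Fin (n G) → ℚ) (f≥0 : ∀ {u v} → Adj G u v → 0ℚ ≤ f u v) where

  private
    summand≥0 : ∀ u v → 0ℚ ≤ (if adj G u v then f u v else 0ℚ)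
    summand≥0 u v with adj G u v in uv
    ... | true  = f≥0 uv
    ... | false = ≤-refl

  adjSum-nonneg : 0ℚ ≤ adjSum G f
  adjSum-nonneg = sumFin-nonneg (n G) (λ u → sumFin-nonneg (n G) (summand≥0 u))

  term≤adjSum : ∀ {x y} → Adj G x y → f x y ≤ adjSum G f
  term≤adjSum {x} {y} xy = subst (_≤ adjSum G f) summand-xy (term≤sumFin² (n G) summand≥0 x y)
    where
    summand-xy : (if adj G x y then f x y else 0ℚ) ≡ f x y
    summand-xy rewrite xy = refl

adjSum-affine : ∀ G p q (f : Fin (n G) → Fin (n G) → ℚ) →
  adjSum G (λ u v → p + q * f u v) ≡ p * adjSum G (λ _ _ → 1ℚ) + q * adjSum G f
adjSum-affine G p q f = trans (sumFin-cong (n G) (λ u → trans (sumFin-cong (n G) (summand u))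
  (sumFin-linear (n G) p q _ _))) (sumFin-linear (n G) p q _ _)
  where
  summand : ∀ u v → (if adj G u v then p + q * f u v else 0ℚ) ≡
                    p * (if adj G u v then 1ℚ else 0ℚ) + q * (if adj G u v then f u v else 0ℚ)
  summand u v with adj G u v
  ... | true  = cong (_+ q * f u v) (sym (*-identityʳ p))
  ... | false = sym (trans (cong₂ _+_ (*-zeroʳ p) (*-zeroʳ q)) (+-identityʳ 0ℚ))

module _ (G : Graph) (f : Fin (n G) → Fin (n G) → ℚ) (f≥0 : ∀ {u v} → Adj G u v → 0ℚ ≤ f u v) where

  private
    summand≥0 : ∀ u v → 0ℚ ≤ (if adj G u v ∧ (toℕ u ℕ.<ᵇ toℕ v) then f u v else 0ℚ)
    summand≥0 u v with adj G u v in uv | toℕ u ℕ.<ᵇ toℕ v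
    ... | true  | true  = f≥0 uv
    ... | true  | false = ≤-refl
    ... | false | _     = ≤-refl

  edgeSum-nonneg : 0ℚ ≤ edgeSum G f
  edgeSum-nonneg = sumFin-nonneg (n G) (λ u → sumFin-nonneg (n G) (summand≥0 u))

  term≤edgeSum : ∀ {x y} → Adj G x y → toℕ x ℕ.< toℕ y → f x y ≤ edgeSum G f
  term≤edgeSum {x} {y} xy x<y =
    subst (_≤ edgeSum G f) summand-xy (term≤sumFin² (n G) summand≥0 x y)
    where
    summand-xy : (if adj G x y ∧ (toℕ x ℕ.<ᵇ toℕ y) then f x y else 0ℚ) ≡ f x y
    summand-xy rewrite xy | Equivalence.to T-≡ (ℕ.<⇒<ᵇ x<y) = refl

module _ (G : Graph) {l : Fin (n G) → Fin (n G) → ℚ} (isLen : IsEdgeLength G l) where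

  private
    l>0 : ∀ {x y} → Adj G x y → 0ℚ < l x y
    l>0 {x} {y} xy = proj₂ (isLen x y xy)

  m₀-nonneg : ∀ u → 0ℚ ≤ m₀ G l u
  m₀-nonneg u = sumFin-nonneg (n G) summand≥0
    where
    summand≥0 : ∀ v → 0ℚ ≤ (if adj G u v then l u v else 0ℚ)
    summand≥0 v with adj G u v in uv
    ... | true  = <⇒≤ (l>0 uv)
    ... | false = ≤-refl

  private
    energy : (Fin (n G) → ℚ) → Fin (n G) → Fin (n G) → ℚ
    energy φ u v = m₁ G l u v * sq (φ u - φ v)

    energy≥0 : ∀ φ {u v} → Adj G u v → 0ℚ ≤ energy φ u v
    energy≥0 φ {u} {v} uv = nonNegative⁻¹ _ {{nonNeg*nonNeg⇒nonNeg (m₁ G l u v)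
      {{nonNegative (inv-nonneg (l>0 uv))}} (sq (φ u - φ v)) {{nonNegative (sq-nonneg (φ u - φ v))}}}}

  dirichlet-nonneg : ∀ φ → 0ℚ ≤ dirichlet G l φ
  dirichlet-nonneg φ = edgeSum-nonneg G (energy φ) (energy≥0 φ)

  dirichlet-edge : ∀ φ {x y} → Adj G x y → m₁ G l x y * sq (φ x - φ y) ≤ dirichlet G l φ
  dirichlet-edge φ {x} {y} xy with ℕ.<-cmp (toℕ x) (toℕ y)
  ... | tri< x<y _ _ = term≤edgeSum G (energy φ) (energy≥0 φ) xy x<y
  ... | tri≈ _ x≡y _ = contradiction (subst (Adj G x) (sym (toℕ-injective x≡y)) xy) (Adj-irrefl {G})
  ... | tri> _ _ y<x =
    subst (_≤ dirichlet G l φ) energy-sym (term≤edgeSum G (energy φ) (energy≥0 φ) yx y<x)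
    where
    yx = Adj-sym {G} xy
    energy-sym : energy φ y x ≡ energy φ x y
    energy-sym = cong₂ _*_ (cong inv (proj₁ (isLen y x yx))) (sq-diff-comm (φ y) (φ x))

  edge-sq≤ : ∀ φ {x y} → Adj G x y → sq (φ x - φ y) ≤ l x y * dirichlet G l φ
  edge-sq≤ φ {x} {y} xy = begin
    sq (φ x - φ y)                        ≡⟨ sym (*-identityˡ _) ⟩
    1ℚ * sq (φ x - φ y)                   ≡⟨ cong (_* sq (φ x - φ y)) (sym (*-inverseʳ-inv (l>0 xy))) ⟩
    l x y * inv (l x y) * sq (φ x - φ y)  ≡⟨ *-assoc (l x y) _ _ ⟩
    l x y * (m₁ G l x y * sq (φ x - φ y)) ≤⟨ *-monoˡ-≤-nonNeg (l x y) {{nonNegative (<⇒≤ (l>0 xy))}}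
                                                               (dirichlet-edge φ xy) ⟩
    l x y * dirichlet G l φ               ∎
    where open ≤-Reasoning

  mass≤shifted : totalMass G l ≡ 1ℚ → ∀ φ → mean G l φ ≡ 0ℚ →
    ∀ c → mass G l φ ≤ sumFin (n G) (λ u → m₀ G l u * sq (φ u - c))
  mass≤shifted total≡1 φ mean≡0 c = subst (mass G l φ ≤_) (sym shifted≡) (p≤p+q (sq-nonneg c))
    where
    open ≡-Reasoning
    shifted≡ : sumFin (n G) (λ u → m₀ G l u * sq (φ u - c)) ≡ mass G l φ + sq c
    shifted≡ = begin
      sumFin (n G) (λ u → m₀ G l u * sq (φ u - c))
        ≡⟨ sumFin-shift-sq (n G) (m₀ G l) φ c ⟩
      mass G l φ + (- (two * c)) * mean G l φ + sq c * totalMass G l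
        ≡⟨ cong₂ (λ m t → mass G l φ + (- (two * c)) * m + sq c * t) mean≡0 total≡1 ⟩
      mass G l φ + (- (two * c)) * 0ℚ + sq c * 1ℚ
        ≡⟨ solve 3 (λ m s t → m :+ t :* con 0ℚ :+ s :* con 1ℚ := m :+ s) refl (mass G l φ) (sq c) (- (two * c)) ⟩
      mass G l φ + sq c
        ∎

totalWalkFactor : ∀ {k} {R : Rel (Fin k) 0ℓ} {r} → (∀ u → Star R u r) → ℚ
totalWalkFactor {k} walkTo = sumFin k (λ u → walkFactor (walkTo u))

totalWalkFactor-nonneg : ∀ {k} {R : Rel (Fin k) 0ℓ} {r} (walkTo : ∀ u → Star R u r) →
  0ℚ ≤ totalWalkFactor walkTo
totalWalkFactor-nonneg {k} walkTo = sumFin-nonneg k (walkFactor-nonneg ∘ walkTo)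

module Poincaré (G : Graph) {l : Fin (n G) → Fin (n G) → ℚ}
  (isLen : IsEdgeLength G l) (total≡1 : totalMass G l ≡ 1ℚ)
  {ε : ℚ} (ε≥0 : 0ℚ ≤ ε)
  {Light : Rel (Fin (n G)) 0ℓ} (light : ∀ {x y} → Light x y → Adj G x y × l x y ≡ ε)
  {r : Fin (n G)} (walkTo : ∀ u → Star Light u r) where

  K : ℚ
  K = totalWalkFactor walkTo

  vertex-sq≤ : ∀ φ u → sq (φ u - φ r) ≤ K * (ε * dirichlet G l φ)
  vertex-sq≤ φ u = begin
    sq (φ u - φ r)                  ≤⟨ walk-sq-bound φ light-sq≤ (walkTo u) ⟩
    walkFactor (walkTo u) * (ε * D) ≤⟨ *-monoʳ-≤-nonNeg (ε * D) {{εD≥0}}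
                                         (term≤sumFin (n G) (walkFactor-nonneg ∘ walkTo) u) ⟩
    K * (ε * D)                     ∎
    where
    open ≤-Reasoning
    D = dirichlet G l φ
    εD≥0 = nonNeg*nonNeg⇒nonNeg ε {{nonNegative ε≥0}} D {{nonNegative (dirichlet-nonneg G isLen φ)}}
    light-sq≤ : ∀ {x y} → Light x y → sq (φ x - φ y) ≤ ε * D
    light-sq≤ {x} {y} xy =
      subst (λ h → sq (φ x - φ y) ≤ h * D) (proj₂ (light xy)) (edge-sq≤ G isLen φ (proj₁ (light xy)))

  mass≤ : ∀ φ → mean G l φ ≡ 0ℚ → mass G l φ ≤ K * (ε * dirichlet G l φ)
  mass≤ φ mean≡0 = ≤-trans (mass≤shifted G isLen total≡1 φ mean≡0 (φ r))
    (sumFin-weighted-≤ (n G) (m₀-nonneg G isLen) total≡1 (vertex-sq≤ φ))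

  dirichlet-pos : ∀ φ → (∃ λ u → φ u ≢ 0ℚ) → mean G l φ ≡ 0ℚ → 0ℚ < dirichlet G l φ
  dirichlet-pos φ (u , φu≢0) mean≡0 with <-cmp 0ℚ (dirichlet G l φ)
  ... | tri< D>0 _ _ = D>0
  ... | tri> _ _ D<0 = contradiction (<-≤-trans D<0 (dirichlet-nonneg G isLen φ)) (<-irrefl refl)
  ... | tri≈ _ 0≡D _ = contradiction (trans (constant u) φr≡0) φu≢0
    where
    constant : ∀ v → φ v ≡ φ r
    constant v = x∙y⁻¹≈ε⇒x≈y (φ v) (φ r) (sq≤0⇒≡0 _ (subst (sq (φ v - φ r) ≤_) K*ε*0≡0 (vertex-sq≤ φ v)))
      where
      K*ε*0≡0 : K * (ε * dirichlet G l φ) ≡ 0ℚ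
      K*ε*0≡0 = trans (cong (λ d → K * (ε * d)) (sym 0≡D)) (trans (cong (K *_) (*-zeroʳ ε)) (*-zeroʳ K))
    φr≡0 : φ r ≡ 0ℚ
    φr≡0 = begin
      φ r                                 ≡⟨ sym (sumFin-weighted-const (n G) total≡1 (φ r)) ⟩
      sumFin (n G) (λ v → m₀ G l v * φ r) ≡⟨ sumFin-cong (n G) (cong (m₀ G l _ *_) ∘ sym ∘ constant) ⟩
      mean G l φ                          ≡⟨ mean≡0 ⟩
      0ℚ                                  ∎
      where open ≡-Reasoning

  M*K*ε<1⇒λ₁> : ∀ {M} → 0ℚ ≤ M → M * K * ε < 1ℚ → λ₁> G l M
  M*K*ε<1⇒λ₁> {M} M≥0 MKε<1 φ φ≢0 mean≡0 = begin-strict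
    M * mass G l φ    ≤⟨ *-monoˡ-≤-nonNeg M {{nonNegative M≥0}} (mass≤ φ mean≡0) ⟩
    M * (K * (ε * D)) ≡⟨ solve 4 (λ m k e d → m :* (k :* (e :* d)) := m :* k :* e :* d) refl M K ε D ⟩
    M * K * ε * D     <⟨ *-monoˡ-<-pos D {{positive (dirichlet-pos φ φ≢0 mean≡0)}} MKε<1 ⟩
    1ℚ * D            ≡⟨ *-identityˡ D ⟩
    D                 ∎
    where
    open ≤-Reasoning
    D = dirichlet G l φ

𝟙 : Bool → ℚ
𝟙 β = if β then 1ℚ else 0ℚ

𝟙-nonneg : ∀ β → 0ℚ ≤ 𝟙 β
𝟙-nonneg true  = <⇒≤ (positive⁻¹ 1ℚ)
𝟙-nonneg false = ≤-refl

module HeavyEdge (G : Graph) {a b : Fin (n G)} (ab : Adj G a b) (C : ℚ) (C≥0 : 0ℚ ≤ C) where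

  private
    heavy : Fin (n G) → Fin (n G) → ℚ
    heavy u v = 𝟙 (does (sameEdge? a b u v))

    heavy≥0 : ∀ u v → 0ℚ ≤ heavy u v
    heavy≥0 u v = 𝟙-nonneg (does (sameEdge? a b u v))

    -- D = 2|E|, and S = 2 counts the two orientations of ab.
    D S : ℚ
    D = adjSum G (λ _ _ → 1ℚ)
    S = adjSum G heavy

    D≥0 : 0ℚ ≤ D
    D≥0 = adjSum-nonneg G (λ _ _ → 1ℚ) (λ _ → <⇒≤ (positive⁻¹ 1ℚ))

    S>0 : 0ℚ < S
    S>0 = <-≤-trans (positive⁻¹ 1ℚ)
      (subst (_≤ S) (cong 𝟙 (dec-true (sameEdge? a b a b) (inj₁ (refl , refl))))
        (term≤adjSum G heavy (λ {u} {v} _ → heavy≥0 u v) ab))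

    C+D+1>0 : 0ℚ < C + D + 1ℚ
    C+D+1>0 = <-≤-trans (positive⁻¹ 1ℚ) (p≤q+p (+-mono-≤ C≥0 D≥0))

    instance
      C+D+1-positive : Positive (C + D + 1ℚ)
      C+D+1-positive = positive C+D+1>0
      S-positive : Positive S
      S-positive = positive S>0

  opaque
    ε : ℚ
    ε = (1/ (C + D + 1ℚ)) {{pos⇒nonZero (C + D + 1ℚ)}}

    ε>0 : 0ℚ < ε
    ε>0 = positive⁻¹ ε {{1/pos⇒pos (C + D + 1ℚ)}}

    [C+D+1]*ε≡1 : (C + D + 1ℚ) * ε ≡ 1ℚ
    [C+D+1]*ε≡1 = *-inverseʳ (C + D + 1ℚ) {{pos⇒nonZero (C + D + 1ℚ)}}

  private
    below-C+D+1 : ∀ {p} → p ≤ C + D → p * ε < 1ℚ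
    below-C+D+1 {p} p≤C+D = subst (p * ε <_) [C+D+1]*ε≡1
      (*-monoˡ-<-pos ε {{positive ε>0}} (≤-<-trans p≤C+D (subst (_< C + D + 1ℚ) (+-identityʳ (C + D))
        (+-monoʳ-< (C + D) (positive⁻¹ 1ℚ)))))

  C*ε<1 : C * ε < 1ℚ
  C*ε<1 = below-C+D+1 {C} (p≤p+q D≥0)

  private
    D*ε<1 : D * ε < 1ℚ
    D*ε<1 = below-C+D+1 {D} (p≤q+p C≥0)

    1-D*ε>0 : 0ℚ < 1ℚ - D * ε
    1-D*ε>0 = subst (_< 1ℚ - D * ε) (+-inverseʳ (D * ε)) (+-monoˡ-< (- (D * ε)) D*ε<1)

  opaque
    t : ℚ
    t = (1ℚ - D * ε) * (1/ S) {{pos⇒nonZero S}}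

    t>0 : 0ℚ < t
    t>0 = positive⁻¹ t {{pos*pos⇒pos (1ℚ - D * ε) {{positive 1-D*ε>0}}
                                     ((1/ S) {{pos⇒nonZero S}}) {{1/pos⇒pos S}}}}

    t*S≡1-D*ε : t * S ≡ 1ℚ - D * ε
    t*S≡1-D*ε = trans (*-assoc (1ℚ - D * ε) ((1/ S) {{pos⇒nonZero S}}) S)
      (trans (cong ((1ℚ - D * ε) *_) (*-inverseˡ S {{pos⇒nonZero S}})) (*-identityʳ (1ℚ - D * ε)))

  length : Fin (n G) → Fin (n G) → ℚ
  length u v = ε + t * heavy u v

  isEdgeLength : IsEdgeLength G length
  isEdgeLength u v _ = cong (λ h → ε + t * h) heavy-sym , length>0
    where
    heavy-sym : heavy u v ≡ heavy v u
    heavy-sym = cong 𝟙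
      (does-⇔ (mk⇔ SameEdge-sym SameEdge-sym) (sameEdge? a b u v) (sameEdge? a b v u))
    length>0 : 0ℚ < length u v
    length>0 = <-≤-trans ε>0 (p≤p+q (nonNegative⁻¹ _
      {{nonNeg*nonNeg⇒nonNeg t {{nonNegative (<⇒≤ t>0)}} (heavy u v) {{nonNegative (heavy≥0 u v)}}}}))

  totalMass≡1 : totalMass G length ≡ 1ℚ
  totalMass≡1 = begin
    totalMass G length      ≡⟨ adjSum-affine G ε t heavy ⟩
    ε * D + t * S           ≡⟨ cong (ε * D +_) t*S≡1-D*ε ⟩
    ε * D + (1ℚ - D * ε)    ≡⟨ solve 2 (λ e d → e :* d :+ (con 1ℚ :- d :* e) := con 1ℚ) refl ε D ⟩
    1ℚ                      ∎
    where open ≡-Reasoning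

  light : ∀ {x y} → AdjAvoiding G a b x y → Adj G x y × length x y ≡ ε
  light {x} {y} (xy , ¬ab) = xy , (begin
    ε + t * heavy x y ≡⟨ cong (λ β → ε + t * 𝟙 β) (dec-false (sameEdge? a b x y) ¬ab) ⟩
    ε + t * 0ℚ        ≡⟨ cong (ε +_) (*-zeroʳ t) ⟩
    ε + 0ℚ            ≡⟨ +-identityʳ ε ⟩
    ε                 ∎)
    where open ≡-Reasoning

mainTheorem1 : (G : Graph) → Connected G → HasCycle G →
    (M : ℚ) → 0ℚ < M →
    Σ (Fin (n G) → Fin (n G) → ℚ) λ l →
      IsEdgeLength G l × totalMass G l ≡ 1ℚ × λ₁> G l M
mainTheorem1 G connected cycle M M>0 with cycle⇒detour G cycle
... | a , b , ab , detour = length , isEdgeLength , totalMass≡1 , M*K*ε<1⇒λ₁> (<⇒≤ M>0) C*ε<1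
  where
  walkTo : ∀ u → Star (AdjAvoiding G a b) u a
  walkTo u = bypass {G} detour (reach⇒walk (connected u a))
  M*K≥0 : 0ℚ ≤ M * totalWalkFactor walkTo
  M*K≥0 = nonNegative⁻¹ _ {{nonNeg*nonNeg⇒nonNeg M {{nonNegative (<⇒≤ M>0)}} (totalWalkFactor walkTo)
    {{nonNegative (totalWalkFactor-nonneg walkTo)}}}}
  open HeavyEdge G ab (M * totalWalkFactor walkTo) M*K≥0
  open Poincaré G isEdgeLength totalMass≡1 (<⇒≤ ε>0) light walkTo
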